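{- Let $(f,C)$ be a low-defect pair of degree $r$. Then the function $\delta_{f,C}:\mathbb{Z}_{\ge0}^r\to\mathbb{R}$ is strictly increasing in each variable.
   Context: $\|n\|$ is the complexity of a positive integer $n$: the least number of $1$'s needed to write $n$ using $1$, $+$, $\times$ and parentheses. For polynomials $f_1$ in $x_1,\dots,x_{r_1}$ and $f_2$ in $x_1,\dots,x_{r_2}$, $(f_1\otimes f_2)(x_1,\dots,x_{r_1+r_2})=f_1(x_1,\dots,x_{r_1})f_2(x_{r_1+1},\dots,x_{r_1+r_2})$. The set of low-defect pairs is the smallest subset $\mathscr{P}\subseteq\mathbb{Z}[x_1,x_2,\dots]\times\mathbb{N}$ such that: (i) for each positive integer constant $k$ and integer $C\ge\|k\|$, $(k,C)\in\mathscr{P}$; (ii) if $(f_1,C_1),(f_2,C_2)\in\mathscr{P}$ then $(f_1\otimes f_2,C_1+C_2)\in\mathscr{P}$; (iii) if $(f,C)\in\mathscr{P}$ with $f$ in $x_1,\dots,x_r$, $c$ a positive integer and $D\ge\|c\|$, then $(f(x_1,\dots,x_r)x_{r+1}+c,C+D)\in\mathscr{P}$. A pair of degree $r$ has $f$ in variables $x_1,\dots,x_r$. Define $\delta_{f,C}(n_1,\dots,n_r)=C+3(n_1+\dots+n_r)-3\log_3 f(3^{n_1},\dots,3^{n_r})$. -}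

module Defs where

open import Data.Nat using (ℕ; zero; suc; _+_; _*_; _^_; _≤_; _<_)
open import Data.Fin using (Fin)
open import Data.Vec using (Vec; take; drop; init; last; map; _[_]≔_)
open import Data.Product using (Σ; _×_)
open import Relation.Binary.PropositionalEquality using (_≡_)

data Expr : Set where
  one  : Expr
  plus : Expr → Expr → Expr
  times : Expr → Expr → Expr

value : Expr → ℕ
value one = 1
value (plus a b) = value a + value b
value (times a b) = value a * value b

ones : Expr → ℕ
ones one = 1
ones (plus a b) = ones a + ones b
ones (times a b) = ones a + ones b

-- C ≥ ‖n‖  (‖n‖ = least number of 1's), i.e. n can be written with at most C ones.
ComplexityAtMost : ℕ → ℕ → Set
ComplexityAtMost n C = Σ Expr λ e → value e ≡ n × ones e ≤ C

data LowDefect : ℕ → ℕ → Set where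
  const  : (k C : ℕ) → 1 ≤ k → ComplexityAtMost k C → LowDefect 0 C
  tensor : ∀ {r₁ r₂ C₁ C₂} → LowDefect r₁ C₁ → LowDefect r₂ C₂ → LowDefect (r₁ + r₂) (C₁ + C₂)
  extend : ∀ {r C} → LowDefect r C → (c D : ℕ) → 1 ≤ c → ComplexityAtMost c D →
           LowDefect (suc r) (C + D)

poly : ∀ {r C} → LowDefect r C → Vec ℕ r → ℕ
poly (const k C _ _) xs = k
poly (tensor {r₁} p q) xs = poly p (take r₁ xs) * poly q (drop r₁ xs)
poly (extend p c D _ _) xs = poly p (init xs) * last xs + c

poly3 : ∀ {r C} → LowDefect r C → Vec ℕ r → ℕ
poly3 p ns = poly p (map (3 ^_) ns)

-- δ_{f,C}(n with n_i := m) < δ_{f,C}(n with n_i := m'), written without logarithms: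
-- C + 3(Σ + m) − 3 log₃ f(a)  <  C + 3(Σ + m') − 3 log₃ f(b)
--   ⇔  f(b) · 3^m < f(a) · 3^{m'}      (f(a), f(b) > 0)
δ-lt : ∀ {r C} → LowDefect r C → Vec ℕ r → Fin r → ℕ → ℕ → Set
δ-lt p ns i m m' = poly3 p (ns [ i ]≔ m') * 3 ^ m < poly3 p (ns [ i ]≔ m) * 3 ^ m'

{-# OPTIONS --safe #-}
module Submission where

-- In each single variable a low-defect polynomial is affine, f = A x + B, with B ≥ 1: every variable
-- occurs exactly once, and each rule keeps the constant term positive. Once the logarithms are
-- exponentiated away, δ increases in nᵢ iff f(…, 3^{nᵢ}, …) / 3^{nᵢ} = A + B / 3^{nᵢ} decreases,
-- which it does strictly because B > 0.

open import Defs
open import Data.Nat using (ℕ; zero; suc; _+_; _*_; _^_; _≤_; _<_; z<s; s<s; >-nonZero)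
open import Data.Nat.Properties
  using (≤-trans; *-mono-≤; m≤n+m; *-comm; +-monoʳ-<; *-monoʳ-<; ^-monoʳ-<; *-distribʳ-+;
         module ≤-Reasoning)
open import Data.Nat.Tactic.RingSolver using (solve-∀)
open import Data.Fin using (Fin; zero; suc; _↑ˡ_; _↑ʳ_; splitAt; join; fromℕ; inject₁)
open import Data.Fin.Properties using (join-splitAt)
open import Data.Fin.Relation.Unary.Top using (view; ‵fromℕ; ‵inject₁)
open import Data.Vec using (Vec; []; _∷_; take; drop; init; last; map; _[_]≔_)
open import Data.Vec.Properties using (map-[]≔)
open import Data.Sum using (_⊎_; inj₁; inj₂)
open import Relation.Binary.PropositionalEquality
  using (_≡_; _≗_; refl; sym; trans; cong; cong₂; subst; subst₂)

private
  variable
    A : Set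
    n : ℕ

take-[]≔-↑ˡ : ∀ m (xs : Vec A (m + n)) (j : Fin m) x → take m (xs [ j ↑ˡ n ]≔ x) ≡ take m xs [ j ]≔ x
take-[]≔-↑ˡ (suc m) (y ∷ xs) zero    x = refl
take-[]≔-↑ˡ (suc m) (y ∷ xs) (suc j) x = cong (y ∷_) (take-[]≔-↑ˡ m xs j x)

drop-[]≔-↑ˡ : ∀ m (xs : Vec A (m + n)) (j : Fin m) x → drop m (xs [ j ↑ˡ n ]≔ x) ≡ drop m xs
drop-[]≔-↑ˡ (suc m) (y ∷ xs) zero    x = refl
drop-[]≔-↑ˡ (suc m) (y ∷ xs) (suc j) x = drop-[]≔-↑ˡ m xs j x

take-[]≔-↑ʳ : ∀ m (xs : Vec A (m + n)) (k : Fin n) x → take m (xs [ m ↑ʳ k ]≔ x) ≡ take m xs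
take-[]≔-↑ʳ zero    xs       k x = refl
take-[]≔-↑ʳ (suc m) (y ∷ xs) k x = cong (y ∷_) (take-[]≔-↑ʳ m xs k x)

drop-[]≔-↑ʳ : ∀ m (xs : Vec A (m + n)) (k : Fin n) x → drop m (xs [ m ↑ʳ k ]≔ x) ≡ drop m xs [ k ]≔ x
drop-[]≔-↑ʳ zero    xs       k x = refl
drop-[]≔-↑ʳ (suc m) (y ∷ xs) k x = drop-[]≔-↑ʳ m xs k x

init-[]≔-fromℕ : ∀ (xs : Vec A (suc n)) x → init (xs [ fromℕ n ]≔ x) ≡ init xs
init-[]≔-fromℕ {n = zero}  (y ∷ []) x = refl
init-[]≔-fromℕ {n = suc n} (y ∷ xs) x = cong (y ∷_) (init-[]≔-fromℕ xs x)

last-[]≔-fromℕ : ∀ (xs : Vec A (suc n)) x → last (xs [ fromℕ n ]≔ x) ≡ x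
last-[]≔-fromℕ {n = zero}  (y ∷ []) x = refl
last-[]≔-fromℕ {n = suc n} (y ∷ xs) x = last-[]≔-fromℕ xs x

init-[]≔-inject₁ : ∀ (xs : Vec A (suc n)) (j : Fin n) x → init (xs [ inject₁ j ]≔ x) ≡ init xs [ j ]≔ x
init-[]≔-inject₁ {n = suc n} (y ∷ xs) zero    x = refl
init-[]≔-inject₁ {n = suc n} (y ∷ xs) (suc j) x = cong (y ∷_) (init-[]≔-inject₁ xs j x)

last-[]≔-inject₁ : ∀ (xs : Vec A (suc n)) (j : Fin n) x → last (xs [ inject₁ j ]≔ x) ≡ last xs
last-[]≔-inject₁ {n = suc n} (y ∷ xs) zero    x = refl
last-[]≔-inject₁ {n = suc n} (y ∷ xs) (suc j) x = last-[]≔-inject₁ xs j x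

record PositiveAffine (g : ℕ → ℕ) : Set where
  field
    slope offset : ℕ
    offset-positive : 1 ≤ offset
    affine : ∀ x → g x ≡ slope * x + offset

positiveAffine-cong : ∀ {g h} → g ≗ h → PositiveAffine g → PositiveAffine h
positiveAffine-cong g≗h aff = record
  { slope = slope ; offset = offset ; offset-positive = offset-positive
  ; affine = λ x → trans (sym (g≗h x)) (affine x)
  }
  where open PositiveAffine aff

positiveAffine-*ʳ : ∀ {g k} → PositiveAffine g → 1 ≤ k → PositiveAffine (λ x → g x * k)
positiveAffine-*ʳ {k = k} aff 1≤k = record
  { slope = slope * k
  ; offset = offset * k
  ; offset-positive = *-mono-≤ offset-positive 1≤k
  ; affine = λ x → trans (cong (_* k) (affine x)) (distrib slope offset x k)
  }
  where
  open PositiveAffine aff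
  distrib : ∀ a b x k → (a * x + b) * k ≡ a * k * x + b * k
  distrib = solve-∀

positiveAffine-*ˡ : ∀ {g k} → 1 ≤ k → PositiveAffine g → PositiveAffine (λ x → k * g x)
positiveAffine-*ˡ {g} {k} 1≤k aff =
  positiveAffine-cong (λ x → *-comm (g x) k) (positiveAffine-*ʳ aff 1≤k)

positiveAffine-*-+ : ∀ {g c} → PositiveAffine g → ∀ y → 1 ≤ c → PositiveAffine (λ x → g x * y + c)
positiveAffine-*-+ {c = c} aff y 1≤c = record
  { slope = slope * y
  ; offset = offset * y + c
  ; offset-positive = ≤-trans 1≤c (m≤n+m c _)
  ; affine = λ x → trans (cong (λ z → z * y + c) (affine x)) (distrib slope offset x y c)
  }
  where
  open PositiveAffine aff
  distrib : ∀ a b x y c → (a * x + b) * y + c ≡ a * y * x + (b * y + c)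
  distrib = solve-∀

positiveAffine-ratio-< : ∀ {g u v} → PositiveAffine g → u < v → g v * u < g u * v
positiveAffine-ratio-< {g} {u} {v} aff u<v = begin-strict
  g v * u                       ≡⟨ cong (_* u) (affine v) ⟩
  (slope * v + offset) * u      ≡⟨ expand slope offset u v ⟩
  slope * u * v + offset * u    <⟨ +-monoʳ-< (slope * u * v) (*-monoʳ-< offset u<v) ⟩
  slope * u * v + offset * v    ≡⟨ sym (*-distribʳ-+ v (slope * u) offset) ⟩
  (slope * u + offset) * v      ≡⟨ cong (_* v) (sym (affine u)) ⟩
  g u * v                       ∎
  where
  open PositiveAffine aff
  open ≤-Reasoning
  instance _ = >-nonZero offset-positive
  expand : ∀ a b u v → (a * v + b) * u ≡ a * u * v + b * u
  expand = solve-∀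

poly-positive : ∀ {r C} (p : LowDefect r C) (xs : Vec ℕ r) → 1 ≤ poly p xs
poly-positive (const k C 1≤k _)    xs = 1≤k
poly-positive (tensor {r₁} p q)    xs =
  *-mono-≤ (poly-positive p (take r₁ xs)) (poly-positive q (drop r₁ xs))
poly-positive (extend p c D 1≤c _) xs = ≤-trans 1≤c (m≤n+m c _)

poly-positiveAffine : ∀ {r C} (p : LowDefect r C) (xs : Vec ℕ r) (i : Fin r) →
                      PositiveAffine (λ x → poly p (xs [ i ]≔ x))
poly-positiveAffine (const k C _ _) xs ()
poly-positiveAffine (tensor {r₁} {r₂} p q) xs i =
  subst (λ i → PositiveAffine (λ x → poly (tensor p q) (xs [ i ]≔ x)))
        (join-splitAt r₁ r₂ i) (at-join (splitAt r₁ i))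
  where
  at-join : (s : Fin r₁ ⊎ Fin r₂) → PositiveAffine (λ x → poly (tensor p q) (xs [ join r₁ r₂ s ]≔ x))
  at-join (inj₁ j) = positiveAffine-cong
    (λ x → sym (cong₂ _*_ (cong (poly p) (take-[]≔-↑ˡ r₁ xs j x))
                          (cong (poly q) (drop-[]≔-↑ˡ r₁ xs j x))))
    (positiveAffine-*ʳ (poly-positiveAffine p (take r₁ xs) j) (poly-positive q (drop r₁ xs)))
  at-join (inj₂ k) = positiveAffine-cong
    (λ x → sym (cong₂ _*_ (cong (poly p) (take-[]≔-↑ʳ r₁ xs k x))
                          (cong (poly q) (drop-[]≔-↑ʳ r₁ xs k x))))
    (positiveAffine-*ˡ (poly-positive p (take r₁ xs)) (poly-positiveAffine q (drop r₁ xs) k))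
poly-positiveAffine (extend p c D 1≤c _) xs i with view i
... | ‵fromℕ = record
  { slope = poly p (init xs)
  ; offset = c
  ; offset-positive = 1≤c
  ; affine = λ x → cong₂ (λ ys z → poly p ys * z + c) (init-[]≔-fromℕ xs x) (last-[]≔-fromℕ xs x)
  }
... | ‵inject₁ j = positiveAffine-cong
  (λ x → sym (cong₂ (λ ys z → poly p ys * z + c) (init-[]≔-inject₁ xs j x) (last-[]≔-inject₁ xs j x)))
  (positiveAffine-*-+ (poly-positiveAffine p (init xs) j) (last xs) 1≤c)

proposition6p1 : ∀ {r C} (p : LowDefect r C) (ns : Vec ℕ r) (i : Fin r) (m m' : ℕ) →
                   m < m' → δ-lt p ns i m m'
proposition6p1 p ns i m m' m<m' =
  subst₂ _<_ (cong (_* 3 ^ m) (poly3-[]≔ m')) (cong (_* 3 ^ m') (poly3-[]≔ m))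
    (positiveAffine-ratio-< (poly-positiveAffine p (map (3 ^_) ns) i) (^-monoʳ-< 3 (s<s z<s) m<m'))
  where
  poly3-[]≔ : ∀ n → poly p (map (3 ^_) ns [ i ]≔ 3 ^ n) ≡ poly3 p (ns [ i ]≔ n)
  poly3-[]≔ n = cong (poly p) (sym (map-[]≔ (3 ^_) ns i))
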